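{- Let $\mathbf{B}$ be an Automath book that is ok. Then: (1) $\Delta_{\mathbf{B}}$ is a legal environment in $\lambda$D. (2) The definition (and primitive) lines of $\mathbf{B}$ correspond one-to-one, in order, with the entries of $\Delta_{\mathbf{B}}$: the sequence of constants introduced in these lines of $\mathbf{B}$ equals the sequence of constants defined in the entries of $\Delta_{\mathbf{B}}$; moreover, for each definition line the typing expression $M : A$ of the line equals the one in the corresponding entry of $\Delta_{\mathbf{B}}$, and likewise for each primitive line the typing expression $\mathrm{PN} : A$ equals the one in the corresponding entry. (3) If $\mathbf{B}$ is moreover clean, then every assumption line of $\mathbf{B}$, say with identifier $x$ and category $A$, contributes its declaration $x : A$ to the contexts of exactly those entries $\Gamma_y \rhd c(\gamma_y) := \ldots$ of $\Delta_{\mathbf{B}}$ for which the constant $c$ depends on $x$, i.e. for which $x \in \gamma_y$, where $y$ is the indicator of the line of $\mathbf{B}$ introducing $c$.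
   Context: Terms: fix disjoint infinite sets Var (variables) and Const (constants). Pseudo-terms of the type system $\lambda$D are built from the sorts $\ast$, $\Box$, variables, instantiated constants $c(T_1,\ldots,T_n)$, abstractions $\lambda x{:}T.\,T'$, products $\Pi x{:}T.\,T'$ and applications $T\,T'$. $\lambda$D is the Calculus of Constructions extended with (parametrised) definitions, as in Nederpelt and Geuvers, "Type Theory and Formal Proof" (2014); its judgements have the form $\Delta ; \Gamma \vdash M : N$, where $\Gamma$ is a context $x_1:A_1,\ldots,x_n:A_n$ and $\Delta$ is an environment, i.e. a list of definitions each of the form $\Gamma \rhd c(x_1,\ldots,x_n) := M : A$ or (primitive definition) $\Gamma \rhd c(x_1,\ldots,x_n) := \mathrm{PN} : A$, where $x_1,\ldots,x_n$ are the variables declared in $\Gamma$. An environment $\Delta$ is legal if there are $\Gamma, M, N$ with $\Delta;\Gamma \vdash M : N$ derivable in $\lambda$D. Automath lines have the form $y \ast z := \text{ --- } : A$ (assumption line, $z\in$ Var), $y \ast c := M : A$ (definition line, $c \in$ Const, $M$ a term) or $y \ast c := \mathrm{PN} : A$ (primitive line), where the indicator $y$ is either the empty symbol $\epsilon$ or a variable, the second entry is the identifier, and $A$ is a term (the category). A book is a finite sequence of lines. A book is coherent if all identifiers of its lines are distinct and every indicator $y \neq \epsilon$ of a line $m$ is the identifier of an assumption line occurring before $m$. For a coherent book and an identifier $z$ of an assumption line $y \ast z := \text{ --- } : A$, define recursively the subject list $\gamma_z := \gamma_y, z$ and typing context $\Gamma_z := \Gamma_y, z : A$, where $\gamma_\epsilon$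 and $\Gamma_\epsilon$ are empty. The predicate "$\mathbf{B}$ ok" and the environment $\Delta_{\mathbf{B}}$ are defined inductively: the empty book is ok with $\Delta_\epsilon$ empty. If $\mathbf{B}$ is ok, then: $\mathbf{B} + (z \ast x := \text{ --- } : A)$ is ok provided $x$ does not occur as identifier in $\mathbf{B}$ and $\Delta_{\mathbf{B}};\Gamma_z \vdash A : s$ for some sort $s \in \{\ast,\Box\}$, and then its environment is $\Delta_{\mathbf{B}}$; $\mathbf{B} + (z \ast c := M : A)$ is ok provided $c$ is fresh for $\mathbf{B}$ and $\Delta_{\mathbf{B}};\Gamma_z \vdash M : A$, and then its environment is $\Delta_{\mathbf{B}}, (\Gamma_z \rhd c(\gamma_z) := M : A)$; $\mathbf{B} + (z \ast c := \mathrm{PN} : A)$ is ok provided $c$ is fresh for $\mathbf{B}$ and $\Delta_{\mathbf{B}};\Gamma_z \vdash A : s$ for some sort $s$, and then its environment is $\Delta_{\mathbf{B}}, (\Gamma_z \rhd c(\gamma_z) := \mathrm{PN} : A)$. (Here $\Gamma_\epsilon,\gamma_\epsilon$ are empty when $z=\epsilon$.) An assumption line with identifier $x$ is a dead-end if $x$ is not the indicator of any later line. A coherent book is clean if none of its assumption lines is a dead-end. -}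

module Defs where

open import Data.Nat using (ℕ; zero; suc; pred; _<ᵇ_; _≡ᵇ_)
open import Data.Bool using (if_then_else_)
open import Data.List using (List; []; _∷_; _++_; [_]; map; zip; _∷ʳ_; length)
open import Data.List.Relation.Unary.Any using (Any)
open import Data.Unit using (⊤)
open import Data.List.Membership.Propositional using (_∈_; _∉_)
open import Data.List.Relation.Binary.Pointwise using (Pointwise)
open import Data.Maybe using (Maybe; nothing; just)
open import Data.Product using (_×_; _,_; proj₁; proj₂; ∃-syntax)
open import Data.Sum using (_⊎_; inj₁; inj₂)
open import Relation.Binary.PropositionalEquality using (_≡_)
open import Relation.Binary.Construct.Closure.Equivalence using (EqClosure)

-- Variables and constants: two disjoint infinite sets.
-- Both are represented by ℕ; they are kept apart by the term
-- constructors (fvar / cst) and by the sum type Ident below.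

Var : Set
Var = ℕ

Const : Set
Const = ℕ

-- Pseudo-terms of λD, up to α-equivalence, in locally nameless style:
-- free variables are names (Var), bound variables are de Bruijn indices.
-- lam A M  is  λx:A.M  and  pi A B  is  Πx:A.B, where the bound x is
-- the index 0 in M (resp. B).

data Sort : Set where
  ⋆ □ : Sort

data Term : Set where
  srt  : Sort → Term
  fvar : Var → Term
  bvar : ℕ → Term
  cst  : Const → List Term → Term
  lam  : Term → Term → Term
  pi   : Term → Term → Term
  app  : Term → Term → Term

mutual
  fv : Term → List Var
  fv (srt s)    = []
  fv (fvar x)   = x ∷ []
  fv (bvar i)   = []
  fv (cst c ts) = fvs ts
  fv (lam A M)  = fv A ++ fv M
  fv (pi A B)   = fv A ++ fv B
  fv (app M N)  = fv M ++ fv N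

  fvs : List Term → List Var
  fvs []       = []
  fvs (t ∷ ts) = fv t ++ fvs ts

mutual
  shift : ℕ → Term → Term
  shift c (srt s)    = srt s
  shift c (fvar x)   = fvar x
  shift c (bvar i)   = if i <ᵇ c then bvar i else bvar (suc i)
  shift c (cst k ts) = cst k (shifts c ts)
  shift c (lam A M)  = lam (shift c A) (shift (suc c) M)
  shift c (pi A B)   = pi (shift c A) (shift (suc c) B)
  shift c (app M N)  = app (shift c M) (shift c N)

  shifts : ℕ → List Term → List Term
  shifts c []       = []
  shifts c (t ∷ ts) = shift c t ∷ shifts c ts

mutual
  substB : ℕ → Term → Term → Term
  substB k u (srt s)    = srt s
  substB k u (fvar x)   = fvar x
  substB k u (bvar i)   =
    if i <ᵇ k then bvar i else (if i ≡ᵇ k then u else bvar (pred i))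
  substB k u (cst c ts) = cst c (substBs k u ts)
  substB k u (lam A M)  = lam (substB k u A) (substB (suc k) (shift 0 u) M)
  substB k u (pi A B)   = pi (substB k u A) (substB (suc k) (shift 0 u) B)
  substB k u (app M N)  = app (substB k u M) (substB k u N)

  substBs : ℕ → Term → List Term → List Term
  substBs k u []       = []
  substBs k u (t ∷ ts) = substB k u t ∷ substBs k u ts

-- B[x := N] where x is the variable bound by the outermost binder:
-- instantiate the body B with N.  With N = fvar x this is "opening".
_⟪_⟫ : Term → Term → Term
B ⟪ N ⟫ = substB 0 N B

Subst : Set
Subst = List (Var × Term)

lookupS : Subst → Var → Term
lookupS []            x = fvar x
lookupS ((y , t) ∷ σ) x = if y ≡ᵇ x then t else lookupS σ x

mutual
  substF : Subst → Term → Term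
  substF σ (srt s)    = srt s
  substF σ (fvar x)   = lookupS σ x
  substF σ (bvar i)   = bvar i
  substF σ (cst c ts) = cst c (substFs σ ts)
  substF σ (lam A M)  = lam (substF σ A) (substF (shiftS σ) M)
  substF σ (pi A B)   = pi (substF σ A) (substF (shiftS σ) B)
  substF σ (app M N)  = app (substF σ M) (substF σ N)

  substFs : Subst → List Term → List Term
  substFs σ []       = []
  substFs σ (t ∷ ts) = substF σ t ∷ substFs σ ts

  shiftS : Subst → Subst
  shiftS []            = []
  shiftS ((y , t) ∷ σ) = (y , shift 0 t) ∷ shiftS σ

-- a context  x₁:A₁, …, xₙ:Aₙ  (left to right);  Γ , x:A  is  Γ ∷ʳ (x , A)
Ctx : Set
Ctx = List (Var × Term)

dom : Ctx → List Var
dom = map proj₁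

data Body : Set where
  term : Term → Body
  PN   : Body

-- a definition  Γ ▷ c(x₁,…,xₙ) := M : A  (or := PN : A), where
-- x₁,…,xₙ = dom Γ are the variables declared in Γ
record Entry : Set where
  constructor _▷_≔_∶_
  field
    ctx  : Ctx
    name : Const
    body : Body
    type : Term
open Entry public

Env : Set
Env = List Entry

mutual
  data _⊢_⟶_ (Δ : Env) : Term → Term → Set where
    β     : ∀ {A M N} → Δ ⊢ app (lam A M) N ⟶ (M ⟪ N ⟫)
    δ     : ∀ {e M Us} → e ∈ Δ → body e ≡ term M →
            length Us ≡ length (ctx e) →
            Δ ⊢ cst (name e) Us ⟶ substF (zip (dom (ctx e)) Us) M
    cstᶜ  : ∀ {c ts ts'} → Δ ⊢ ts ⟶ₗ ts' → Δ ⊢ cst c ts ⟶ cst c ts'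
    lamˡ  : ∀ {A A' M} → Δ ⊢ A ⟶ A' → Δ ⊢ lam A M ⟶ lam A' M
    lamʳ  : ∀ {A M M'} → Δ ⊢ M ⟶ M' → Δ ⊢ lam A M ⟶ lam A M'
    piˡ   : ∀ {A A' B} → Δ ⊢ A ⟶ A' → Δ ⊢ pi A B ⟶ pi A' B
    piʳ   : ∀ {A B B'} → Δ ⊢ B ⟶ B' → Δ ⊢ pi A B ⟶ pi A B'
    appˡ  : ∀ {M M' N} → Δ ⊢ M ⟶ M' → Δ ⊢ app M N ⟶ app M' N
    appʳ  : ∀ {M N N'} → Δ ⊢ N ⟶ N' → Δ ⊢ app M N ⟶ app M N'

  data _⊢_⟶ₗ_ (Δ : Env) : List Term → List Term → Set where
    here  : ∀ {t t' ts} → Δ ⊢ t ⟶ t' → Δ ⊢ (t ∷ ts) ⟶ₗ (t' ∷ ts)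
    there : ∀ {t ts ts'} → Δ ⊢ ts ⟶ₗ ts' → Δ ⊢ (t ∷ ts) ⟶ₗ (t ∷ ts')

_⊢_≡βδ_ : Env → Term → Term → Set
Δ ⊢ A ≡βδ B = EqClosure (Δ ⊢_⟶_) A B

-- The derivation rules of λD (Nederpelt & Geuvers, Fig. 10.x),
-- with CoC sorts s ∈ {⋆, □}.  Binders: the bound variable is given a
-- fresh name x (not in dom Γ and not free in the body).

infix 3 _︔_⊢_∶_

data _︔_⊢_∶_ : Env → Ctx → Term → Term → Set where
  sort  : [] ︔ [] ⊢ srt ⋆ ∶ srt □
  var   : ∀ {Δ Γ A s x} → Δ ︔ Γ ⊢ A ∶ srt s → x ∉ dom Γ →
          Δ ︔ Γ ∷ʳ (x , A) ⊢ fvar x ∶ A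
  weak  : ∀ {Δ Γ A B C s x} → Δ ︔ Γ ⊢ A ∶ B → Δ ︔ Γ ⊢ C ∶ srt s → x ∉ dom Γ →
          Δ ︔ Γ ∷ʳ (x , C) ⊢ A ∶ B
  form  : ∀ {Δ Γ A B s₁ s₂ x} → Δ ︔ Γ ⊢ A ∶ srt s₁ →
          x ∉ dom Γ → x ∉ fv B →
          Δ ︔ Γ ∷ʳ (x , A) ⊢ B ⟪ fvar x ⟫ ∶ srt s₂ →
          Δ ︔ Γ ⊢ pi A B ∶ srt s₂
  appl  : ∀ {Δ Γ M N A B} → Δ ︔ Γ ⊢ M ∶ pi A B → Δ ︔ Γ ⊢ N ∶ A →
          Δ ︔ Γ ⊢ app M N ∶ B ⟪ N ⟫
  abst  : ∀ {Δ Γ A M B s x} →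
          x ∉ dom Γ → x ∉ fv M → x ∉ fv B →
          Δ ︔ Γ ∷ʳ (x , A) ⊢ M ⟪ fvar x ⟫ ∶ B ⟪ fvar x ⟫ →
          Δ ︔ Γ ⊢ pi A B ∶ srt s →
          Δ ︔ Γ ⊢ lam A M ∶ pi A B
  conv  : ∀ {Δ Γ A B B' s} → Δ ︔ Γ ⊢ A ∶ B → Δ ︔ Γ ⊢ B' ∶ srt s →
          Δ ⊢ B ≡βδ B' → Δ ︔ Γ ⊢ A ∶ B'
  def   : ∀ {Δ Γ K L Γ' a M N} → Δ ︔ Γ ⊢ K ∶ L → Δ ︔ Γ' ⊢ M ∶ N →
          a ∉ map name Δ →
          Δ ∷ʳ (Γ' ▷ a ≔ term M ∶ N) ︔ Γ ⊢ K ∶ L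
  defPN : ∀ {Δ Γ K L Γ' a N s} → Δ ︔ Γ ⊢ K ∶ L → Δ ︔ Γ' ⊢ N ∶ srt s →
          a ∉ map name Δ →
          Δ ∷ʳ (Γ' ▷ a ≔ PN ∶ N) ︔ Γ ⊢ K ∶ L
  inst  : ∀ {Δ Γ Γ' a M N Us} → Δ ︔ Γ ⊢ srt ⋆ ∶ srt □ →
          (Γ' ▷ a ≔ term M ∶ N) ∈ Δ →
          Pointwise (λ U xA → Δ ︔ Γ ⊢ U ∶ substF (zip (dom Γ') Us) (proj₂ xA)) Us Γ' →
          Δ ︔ Γ ⊢ cst a Us ∶ substF (zip (dom Γ') Us) N
  instPN : ∀ {Δ Γ Γ' a N Us} → Δ ︔ Γ ⊢ srt ⋆ ∶ srt □ →
          (Γ' ▷ a ≔ PN ∶ N) ∈ Δ →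
          Pointwise (λ U xA → Δ ︔ Γ ⊢ U ∶ substF (zip (dom Γ') Us) (proj₂ xA)) Us Γ' →
          Δ ︔ Γ ⊢ cst a Us ∶ substF (zip (dom Γ') Us) N

Legal : Env → Set
Legal Δ = ∃[ Γ ] ∃[ M ] ∃[ N ] (Δ ︔ Γ ⊢ M ∶ N)

-- indicator: ε (nothing) or a variable
Indicator : Set
Indicator = Maybe Var

data Line : Set where
  assume : Indicator → Var → Term → Line
  -- y ∗ c := M : A  (body = term M)  or  y ∗ c := PN : A  (body = PN)
  defn   : Indicator → Const → Body → Term → Line

data Book : Set where
  ε   : Book
  _+_ : Book → Line → Book

infixl 5 _+_

lines : Book → List Line
lines ε       = []
lines (B + l) = lines B ∷ʳ l

Ident : Set
Ident = Var ⊎ Const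

identOf : Line → Ident
identOf (assume _ x _) = inj₁ x
identOf (defn _ c _ _) = inj₂ c

indOf : Line → Indicator
indOf (assume y _ _) = y
indOf (defn y _ _ _) = y

idents : Book → List Ident
idents B = map identOf (lines B)

assumeIds : Book → List Var
assumeIds ε                  = []
assumeIds (B + assume _ x _) = assumeIds B ∷ʳ x
assumeIds (B + defn _ _ _ _) = assumeIds B

ValidInd : Book → Indicator → Set
ValidInd B nothing  = ⊤
ValidInd B (just y) = y ∈ assumeIds B

data Coherent : Book → Set where
  coh-ε : Coherent ε
  coh-+ : ∀ {B l} → Coherent B → identOf l ∉ idents B → ValidInd B (indOf l) →
          Coherent (B + l)

mutual
  γ : Book → Indicator → List Var
  γ B nothing  = []
  γ B (just z) = γV B z

  γV : Book → Var → List Var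
  γV ε z = []
  γV (B + assume y x A) z = if x ≡ᵇ z then γ B y ∷ʳ x else γV B z
  γV (B + defn _ _ _ _) z = γV B z

mutual
  Γ : Book → Indicator → Ctx
  Γ B nothing  = []
  Γ B (just z) = ΓV B z

  ΓV : Book → Var → Ctx
  ΓV ε z = []
  ΓV (B + assume y x A) z = if x ≡ᵇ z then Γ B y ∷ʳ (x , A) else ΓV B z
  ΓV (B + defn _ _ _ _) z = ΓV B z

-- "B ok, with environment Δ_B = Δ"
data Ok : Book → Env → Set where
  ok-ε      : Ok ε []
  ok-assume : ∀ {B Δ z x A s} → Ok B Δ → ValidInd B z →
              inj₁ x ∉ idents B →
              Δ ︔ Γ B z ⊢ A ∶ srt s →
              Ok (B + assume z x A) Δ
  ok-def    : ∀ {B Δ z c M A} → Ok B Δ → ValidInd B z →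
              inj₂ c ∉ idents B →
              Δ ︔ Γ B z ⊢ M ∶ A →
              Ok (B + defn z c (term M) A) (Δ ∷ʳ (Γ B z ▷ c ≔ term M ∶ A))
  ok-prim   : ∀ {B Δ z c A s} → Ok B Δ → ValidInd B z →
              inj₂ c ∉ idents B →
              Δ ︔ Γ B z ⊢ A ∶ srt s →
              Ok (B + defn z c PN A) (Δ ∷ʳ (Γ B z ▷ c ≔ PN ∶ A))

record DLine : Set where
  constructor dline
  field
    dind   : Indicator
    dconst : Const
    dbody  : Body
    dtype  : Term
open DLine public

defLines : Book → List DLine
defLines ε                  = []
defLines (B + assume _ _ _) = defLines B
defLines (B + defn y c b A) = defLines B ∷ʳ dline y c b A

-- an assumption line (y ∗ x := — : A), occurring in B with lines `post`
-- after it, is a dead-end if x is the indicator of no line in `post`;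
-- B is clean if it is coherent and none of its assumption lines is a dead-end
Clean : Book → Set
Clean B = Coherent B ×
  (∀ pre y x A post → lines B ≡ pre ++ assume y x A ∷ post →
     Any (λ l → indOf l ≡ just x) post)

{-# OPTIONS --safe #-}
module Submission where

-- The environment Δ_B grows exactly at the definition and primitive lines,
-- each time by an entry Γ_y ▷ c(γ_y) := … whose typing judgement is the one
-- checked for the line; so the δ-rules (def, defPN) of λD extend the
-- legality of Δ_B, provided c is fresh for Δ_B, which follows from c being
-- fresh for B.  An invariant relating the definition lines of B to the
-- entries of Δ_B gives (1) and (2).  For (3), the context of the entry for c
-- is Γ_y, whose domain is γ_y, and a variable in Γ_y is declared with the
-- category of its (unique, by coherence) assumption line.

open import Defs
open import Data.Bool using (true; false)
open import Data.List using ([]; _∷_; _∷ʳ_; map)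
open import Data.List.Membership.Propositional using (_∈_; _∉_)
open import Data.List.Membership.Propositional.Properties
  using (∈-map⁺; ∈-map⁻; ∈-++⁻; ∈-++⁺ˡ; ∈-++⁺ʳ)
open import Data.List.Properties using (map-++)
open import Data.List.Relation.Binary.Pointwise
  using (Pointwise; []; _∷_; ++⁺; map⁺; Pointwise-≡⇒≡)
import Data.List.Relation.Binary.Pointwise as Pointwise
open import Data.List.Relation.Unary.Any using (here; there)
open import Data.Maybe using (nothing; just)
open import Data.Nat using (_≡ᵇ_)
open import Data.Nat.Properties using (≡ᵇ⇒≡)
open import Data.Product using (_×_; _,_; ∃; ∃₂; proj₁)
open import Data.Sum using (_⊎_; inj₁; inj₂)
open import Data.Unit using (tt)
open import Data.Empty using (⊥-elim)
open import Function using (_∘_)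
open import Function.Bundles using (_⇔_; mk⇔)
open import Relation.Binary.PropositionalEquality
  using (_≡_; refl; sym; trans; cong; subst)

∈-∷ʳ⁻ : ∀ {a} {A : Set a} {v x : A} xs → v ∈ xs ∷ʳ x → v ∈ xs ⊎ v ≡ x
∈-∷ʳ⁻ xs v∈ with ∈-++⁻ xs v∈
... | inj₁ v∈xs        = inj₁ v∈xs
... | inj₂ (here v≡x)  = inj₂ v≡x

Pointwise-∈ʳ : ∀ {a b r} {A : Set a} {B : Set b} {R : A → B → Set r} {xs ys y} →
               Pointwise R xs ys → y ∈ ys → ∃ λ x → x ∈ xs × R x y
Pointwise-∈ʳ (r ∷ _)  (here refl) = _ , here refl , r
Pointwise-∈ʳ (_ ∷ rs) (there y∈) with Pointwise-∈ʳ rs y∈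
... | x , x∈ , r = x , there x∈ , r

Legal-∷ʳ-def : ∀ {Δ Γ' a M N} → Legal Δ → Δ ︔ Γ' ⊢ M ∶ N → a ∉ map name Δ →
               Legal (Δ ∷ʳ (Γ' ▷ a ≔ term M ∶ N))
Legal-∷ʳ-def (Γ , K , L , ⊢K) ⊢M a∉ = Γ , K , L , def ⊢K ⊢M a∉

Legal-∷ʳ-defPN : ∀ {Δ Γ' a N s} → Legal Δ → Δ ︔ Γ' ⊢ N ∶ srt s → a ∉ map name Δ →
                 Legal (Δ ∷ʳ (Γ' ▷ a ≔ PN ∶ N))
Legal-∷ʳ-defPN (Γ , K , L , ⊢K) ⊢N a∉ = Γ , K , L , defPN ⊢K ⊢N a∉

identOf-∈-idents : ∀ B {l} → l ∈ lines B → identOf l ∈ idents B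
identOf-∈-idents B = ∈-map⁺ identOf

assumeIds⇒lines : ∀ B {x} → x ∈ assumeIds B → ∃₂ λ w A → assume w x A ∈ lines B
assumeIds⇒lines ε ()
assumeIds⇒lines (B + assume w x A) x∈ with ∈-∷ʳ⁻ (assumeIds B) x∈
... | inj₁ x∈B = let w' , A' , l∈ = assumeIds⇒lines B x∈B in w' , A' , ∈-++⁺ˡ l∈
... | inj₂ refl = w , A , ∈-++⁺ʳ (lines B) (here refl)
assumeIds⇒lines (B + defn _ _ _ _) x∈ =
  let w , A , l∈ = assumeIds⇒lines B x∈ in w , A , ∈-++⁺ˡ l∈

defLines⇒lines : ∀ B {d} → d ∈ defLines B →
                 defn (dind d) (dconst d) (dbody d) (dtype d) ∈ lines B
defLines⇒lines ε ()
defLines⇒lines (B + assume _ _ _) d∈ = ∈-++⁺ˡ (defLines⇒lines B d∈)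
defLines⇒lines (B + defn _ _ _ _) d∈ with ∈-∷ʳ⁻ (defLines B) d∈
... | inj₁ d∈B  = ∈-++⁺ˡ (defLines⇒lines B d∈B)
... | inj₂ refl = ∈-++⁺ʳ (lines B) (here refl)

dconst-∈-idents : ∀ B {c} → c ∈ map dconst (defLines B) → inj₂ c ∈ idents B
dconst-∈-idents B c∈ with ∈-map⁻ dconst c∈
... | d , d∈ , refl = identOf-∈-idents B (defLines⇒lines B d∈)

Ok⇒Coherent : ∀ {B Δ} → Ok B Δ → Coherent B
Ok⇒Coherent ok-ε                       = coh-ε
Ok⇒Coherent (ok-assume ok valid fresh _) = coh-+ (Ok⇒Coherent ok) fresh valid
Ok⇒Coherent (ok-def ok valid fresh _)    = coh-+ (Ok⇒Coherent ok) fresh valid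
Ok⇒Coherent (ok-prim ok valid fresh _)   = coh-+ (Ok⇒Coherent ok) fresh valid

identOf-injective : ∀ {B l₁ l₂} → Coherent B → l₁ ∈ lines B → l₂ ∈ lines B →
                    identOf l₁ ≡ identOf l₂ → l₁ ≡ l₂
identOf-injective coh-ε () _ _
identOf-injective {B + l} (coh-+ coh fresh _) l₁∈ l₂∈ same
  with ∈-∷ʳ⁻ (lines B) l₁∈ | ∈-∷ʳ⁻ (lines B) l₂∈
... | inj₁ l₁∈B | inj₁ l₂∈B = identOf-injective coh l₁∈B l₂∈B same
... | inj₁ l₁∈B | inj₂ refl = ⊥-elim (fresh (subst (_∈ idents B) same (identOf-∈-idents B l₁∈B)))
... | inj₂ refl | inj₁ l₂∈B = ⊥-elim (fresh (subst (_∈ idents B) (sym same) (identOf-∈-idents B l₂∈B)))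
... | inj₂ refl | inj₂ refl = refl

ValidInd-+ : ∀ B l {y} → ValidInd B y → ValidInd (B + l) y
ValidInd-+ B l {nothing} _                  = tt
ValidInd-+ B (assume _ _ _) {just _} z∈ = ∈-++⁺ˡ z∈
ValidInd-+ B (defn _ _ _ _) {just _} z∈ = z∈

Γ-+-assume : ∀ B {w x A} y → x ∉ assumeIds B → ValidInd B y →
             Γ (B + assume w x A) y ≡ Γ B y
Γ-+-assume B nothing _ _ = refl
Γ-+-assume B {x = x} (just z) x∉ z∈ with x ≡ᵇ z | ≡ᵇ⇒≡ x z
... | false | _    = refl
... | true  | x≡z = ⊥-elim (x∉ (subst (_∈ assumeIds B) (sym (x≡z tt)) z∈))

Γ-+-defn : ∀ B {w c b A} y → Γ (B + defn w c b A) y ≡ Γ B y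
Γ-+-defn B nothing  = refl
Γ-+-defn B (just z) = refl

mutual
  dom-Γ : ∀ B y → dom (Γ B y) ≡ γ B y
  dom-Γ B nothing  = refl
  dom-Γ B (just z) = dom-ΓV B z

  dom-ΓV : ∀ B z → dom (ΓV B z) ≡ γV B z
  dom-ΓV ε z = refl
  dom-ΓV (B + assume w x A) z with x ≡ᵇ z
  ... | true  = trans (map-++ proj₁ (Γ B w) _) (cong (_∷ʳ x) (dom-Γ B w))
  ... | false = dom-ΓV B z
  dom-ΓV (B + defn _ _ _ _) z = dom-ΓV B z

mutual
  Γ⇒lines : ∀ B y {x A} → (x , A) ∈ Γ B y → ∃ λ w → assume w x A ∈ lines B
  Γ⇒lines B nothing  ()
  Γ⇒lines B (just z) xA∈ = ΓV⇒lines B z xA∈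

  ΓV⇒lines : ∀ B z {x A} → (x , A) ∈ ΓV B z → ∃ λ w → assume w x A ∈ lines B
  ΓV⇒lines ε z ()
  ΓV⇒lines (B + assume w x A) z xA∈ with x ≡ᵇ z
  ΓV⇒lines (B + assume w x A) z xA∈ | true with ∈-∷ʳ⁻ (Γ B w) xA∈
  ... | inj₁ xA∈Γ = let u , l∈ = Γ⇒lines B w xA∈Γ in u , ∈-++⁺ˡ l∈
  ... | inj₂ refl = w , ∈-++⁺ʳ (lines B) (here refl)
  ΓV⇒lines (B + assume w x A) z xA∈ | false =
    let u , l∈ = ΓV⇒lines B z xA∈ in u , ∈-++⁺ˡ l∈
  ΓV⇒lines (B + defn _ _ _ _) z xA∈ =
    let u , l∈ = ΓV⇒lines B z xA∈ in u , ∈-++⁺ˡ l∈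

∈-Γ⇔∈-γ : ∀ {B y x A} → Coherent B → assume y x A ∈ lines B →
          ∀ y' → (x , A) ∈ Γ B y' ⇔ x ∈ γ B y'
∈-Γ⇔∈-γ {B} {x = x} {A} coh x-line y' = mk⇔ to from
  where
  to : (x , A) ∈ Γ B y' → x ∈ γ B y'
  to xA∈ = subst (x ∈_) (dom-Γ B y') (∈-map⁺ proj₁ xA∈)

  from : x ∈ γ B y' → (x , A) ∈ Γ B y'
  from x∈ with ∈-map⁻ proj₁ (subst (x ∈_) (sym (dom-Γ B y')) x∈)
  ... | (_ , A') , xA'∈ , refl with Γ⇒lines B y' xA'∈
  ... | _ , x-line' with identOf-injective coh x-line x-line' refl
  ... | refl = xA'∈

record Corresponds (B : Book) (d : DLine) (e : Entry) : Set where
  field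
    name≡  : name e ≡ dconst d
    body≡  : body e ≡ dbody d
    type≡  : type e ≡ dtype d
    ctx≡   : ctx e ≡ Γ B (dind d)
    valid  : ValidInd B (dind d)
open Corresponds

Corresponds-+ : ∀ {B l d e} → (∀ {y} → ValidInd B y → Γ (B + l) y ≡ Γ B y) →
                Corresponds B d e → Corresponds (B + l) d e
Corresponds-+ {B} {l} Γ-stable r = record
  { name≡ = name≡ r
  ; body≡ = body≡ r
  ; type≡ = type≡ r
  ; ctx≡  = trans (ctx≡ r) (sym (Γ-stable (valid r)))
  ; valid = ValidInd-+ B l (valid r)
  }

names-correspond : ∀ {B ds Δ} → Pointwise (Corresponds B) ds Δ →
                   map dconst ds ≡ map name Δ
names-correspond = Pointwise-≡⇒≡ ∘ map⁺ dconst name ∘ Pointwise.map (sym ∘ name≡)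

fresh⇒∉names : ∀ {B Δ c} → Pointwise (Corresponds B) (defLines B) Δ →
               inj₂ c ∉ idents B → c ∉ map name Δ
fresh⇒∉names {B} rs c∉ c∈ =
  c∉ (dconst-∈-idents B (subst (_ ∈_) (sym (names-correspond rs)) c∈))

Corresponds-defn : ∀ {B Δ z c b A} → ValidInd B z →
                   Pointwise (Corresponds B) (defLines B) Δ →
                   Pointwise (Corresponds (B + defn z c b A))
                             (defLines (B + defn z c b A)) (Δ ∷ʳ (Γ B z ▷ c ≔ b ∶ A))
Corresponds-defn {B} {z = z} {c} {b} {A} z-valid rs =
  ++⁺ (Pointwise.map (Corresponds-+ (λ {y} _ → Γ-+-defn B y)) rs) (new ∷ [])
  where
  new : Corresponds (B + defn z c b A) (dline z c b A) (Γ B z ▷ c ≔ b ∶ A)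
  new = record { name≡ = refl ; body≡ = refl ; type≡ = refl
               ; ctx≡ = sym (Γ-+-defn B z) ; valid = ValidInd-+ B _ z-valid }

Ok⇒Corresponds : ∀ {B Δ} → Ok B Δ → Pointwise (Corresponds B) (defLines B) Δ
Ok⇒Corresponds ok-ε = []
Ok⇒Corresponds {B + assume z x A} (ok-assume ok _ x-fresh _) =
  Pointwise.map (Corresponds-+ (Γ-+-assume B _ x∉)) (Ok⇒Corresponds ok)
  where
  x∉ : x ∉ assumeIds B
  x∉ x∈ = let _ , _ , l∈ = assumeIds⇒lines B x∈ in x-fresh (identOf-∈-idents B l∈)
Ok⇒Corresponds (ok-def ok z-valid _ _)  = Corresponds-defn z-valid (Ok⇒Corresponds ok)
Ok⇒Corresponds (ok-prim ok z-valid _ _) = Corresponds-defn z-valid (Ok⇒Corresponds ok)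

Ok⇒Legal : ∀ {B Δ} → Ok B Δ → Legal Δ
Ok⇒Legal ok-ε = [] , _ , _ , sort
Ok⇒Legal (ok-assume ok _ _ _) = Ok⇒Legal ok
Ok⇒Legal (ok-def ok _ c-fresh ⊢M) =
  Legal-∷ʳ-def (Ok⇒Legal ok) ⊢M (fresh⇒∉names (Ok⇒Corresponds ok) c-fresh)
Ok⇒Legal (ok-prim ok _ c-fresh ⊢A) =
  Legal-∷ʳ-defPN (Ok⇒Legal ok) ⊢A (fresh⇒∉names (Ok⇒Corresponds ok) c-fresh)

ctx-of-defn : ∀ {B Δ y c b A e} → Coherent B →
              Pointwise (Corresponds B) (defLines B) Δ →
              defn y c b A ∈ lines B → e ∈ Δ → name e ≡ c → ctx e ≡ Γ B y
ctx-of-defn {B} coh rs c-line e∈ e-named-c with Pointwise-∈ʳ rs e∈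
... | d , d∈ , r
  with identOf-injective coh (defLines⇒lines B d∈) c-line
         (cong inj₂ (trans (sym (name≡ r)) e-named-c))
... | refl = ctx≡ r

theorem4 : (B : Book) (Δ : Env) → Ok B Δ →
    -- (1) Δ_B is a legal environment
    Legal Δ
    -- (2) definition/primitive lines correspond, in order, to the entries of Δ_B
    × (map dconst (defLines B) ≡ map name Δ
       × Pointwise (λ d e → dbody d ≡ body e × dtype d ≡ type e) (defLines B) Δ)
    -- (3) for clean B: the assumption x : A occurs in the context of exactly
    --     those entries for c with x ∈ γ_y, y the indicator of c's line
    × (Clean B →
       (y : Indicator) (x : Var) (A : Term) → assume y x A ∈ lines B →
       (y' : Indicator) (c : Const) (b : Body) (A' : Term) → defn y' c b A' ∈ lines B →
       (e : Entry) → e ∈ Δ → name e ≡ c →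
       ((x , A) ∈ ctx e ⇔ x ∈ γ B y'))
theorem4 B Δ ok =
  Ok⇒Legal ok ,
  (names-correspond rs , Pointwise.map (λ r → sym (body≡ r) , sym (type≡ r)) rs) ,
  λ _ y x A x-line y' c b A' c-line e e∈ e-named-c →
    subst (λ Γ' → (x , A) ∈ Γ' ⇔ x ∈ γ B y')
          (sym (ctx-of-defn coh rs c-line e∈ e-named-c))
          (∈-Γ⇔∈-γ coh x-line y')
  where
  rs  = Ok⇒Corresponds ok
  coh = Ok⇒Coherent ok
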